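{- Let $q\ge5$ be a prime power. For every integer $k$ with $2q\le k\le 3(q-1)$ there exists a minimal blocking set of size $k$ in $\mathrm{PG}(2,q)$ with the $r_\infty$-property (with respect to some of its points).
   Context: A blocking set of $\mathrm{PG}(2,q)$ is a set of points meeting every line and containing no line; minimal if no proper subset is a blocking set. A line is tangent to a point set $\mathcal{K}$ if it meets $\mathcal{K}$ in exactly one point, secant if in more than one. A blocking set $\mathcal{B}$ has the $r_\infty$-property with respect to $P\in\mathcal{B}$ if exactly one line through $P$ is tangent to $\mathcal{B}$ and all other lines through $P$ are secants. -}

module Defs where

open import Level using (0ℓ)
open import Data.Nat using (ℕ; suc; _^_)
open import Data.Nat.Primality using (Prime)
open import Data.Fin using (Fin)
open import Data.Product using (Σ; ∃; ∃-syntax; _×_; _,_)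
open import Data.Sum using (_⊎_; inj₁; inj₂)
open import Data.Unit using (⊤; tt)
open import Relation.Nullary using (¬_)
open import Relation.Binary.PropositionalEquality using (_≡_)
open import Algebra.Bundles using (CommutativeRing)

IsPrimePower : ℕ → Set
IsPrimePower q = ∃[ p ] ∃[ n ] (Prime p × q ≡ p ^ suc n)

record FiniteField (q : ℕ) : Set₁ where
  field
    cring    : CommutativeRing 0ℓ 0ℓ
  open CommutativeRing cring public
  field
    1≉0      : ¬ (1# ≈ 0#)
    inverse  : ∀ x → ¬ (x ≈ 0#) → ∃[ y ] (x * y ≈ 1#)
    enum     : Fin q → Carrier
    enum-inj : ∀ i j → enum i ≈ enum j → i ≡ j
    enum-sur : ∀ x → ∃[ i ] (enum i ≈ x)

module PG {q : ℕ} (F : FiniteField q) where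
  open FiniteField F

  -- Points (resp. lines) are represented by their normalised homogeneous
  -- coordinates: (1,y,z), (0,1,z) or (0,0,1) (resp. [1,b,c], [0,1,c], [0,0,1]).
  -- Every point of PG(2,q) has exactly one such representative.
  Point : Set
  Point = (Carrier × Carrier) ⊎ (Carrier ⊎ ⊤)

  Line : Set
  Line = Point

  record Triple : Set where
    constructor ⟨_,_,_⟩
    field
      c₁ c₂ c₃ : Carrier

  coords : Point → Triple
  coords (inj₁ (y , z))    = ⟨ 1# , y , z ⟩
  coords (inj₂ (inj₁ z))   = ⟨ 0# , 1# , z ⟩
  coords (inj₂ (inj₂ tt))  = ⟨ 0# , 0# , 1# ⟩

  _≈T_ : Triple → Triple → Set
  ⟨ a , b , c ⟩ ≈T ⟨ a' , b' , c' ⟩ = (a ≈ a') × (b ≈ b') × (c ≈ c')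

  _≈P_ : Point → Point → Set
  P ≈P Q = coords P ≈T coords Q

  _≈L_ : Line → Line → Set
  _≈L_ = _≈P_

  _on_ : Point → Line → Set
  P on L with coords P | coords L
  ... | ⟨ x , y , z ⟩ | ⟨ a , b , c ⟩ = (a * x + b * y + c * z) ≈ 0#

  PointSet : Set₁
  PointSet = Point → Set

  RespectsEq : PointSet → Set
  RespectsEq S = ∀ {P Q} → P ≈P Q → S P → S Q

  Meets : PointSet → Line → Set
  Meets S L = ∃[ P ] (P on L × S P)

  ContainsLine : PointSet → Line → Set
  ContainsLine S L = ∀ P → P on L → S P

  IsBlockingSet : PointSet → Set
  IsBlockingSet S = ∀ L → Meets S L × ¬ ContainsLine S L

  IsMinimalBlockingSet : PointSet → Set₁
  IsMinimalBlockingSet S =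
    IsBlockingSet S ×
    (∀ (S' : PointSet) → RespectsEq S' → (∀ P → S' P → S P) →
       (∃[ P ] (S P × ¬ S' P)) → ¬ IsBlockingSet S')

  Tangent : PointSet → Line → Set
  Tangent S L = ∃[ P ] (P on L × S P × (∀ Q → Q on L → S Q → Q ≈P P))

  Secant : PointSet → Line → Set
  Secant S L = ∃[ P ] ∃[ Q ] (P on L × S P × Q on L × S Q × ¬ (P ≈P Q))

  RInfProperty : PointSet → Point → Set
  RInfProperty S P =
    S P ×
    ∃[ L ] (P on L × Tangent S L ×
            (∀ L' → P on L' → Tangent S L' → L' ≈L L) ×
            (∀ L' → P on L' → ¬ (L' ≈L L) → Secant S L'))

  SetOf : ∀ {k} → (Fin k → Point) → PointSet
  SetOf B P = ∃[ i ] (B i ≈P P)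

  Distinct : ∀ {k} → (Fin k → Point) → Set
  Distinct B = ∀ i j → B i ≈P B j → i ≡ j

  HasSize : PointSet → ℕ → Set
  HasSize S k = ∃[ B ] (Distinct {k} B × (∀ P → S P → SetOf B P) × (∀ P → SetOf B P → S P))

module Submission where

-- Work in the affine chart x = 1 with coordinates (y, z) and enumerate the field as ι : F → {0, …, q - 1}
-- with ι 0 = 0, ι 1 = 1 and ι (- 1) ≤ 2.  For thresholds σ, τ, m the set B consists of the directions
-- (0 : 1 : s) with ι s > σ, the points (1 : y : 0) with ι y > τ, the points (1 : 0 : z) with ι z > m and
-- the diagonal points (1 : t : t) with 0 < ι t ≤ m.  For σ = 0 and τ = m ≠ 1 it has 3(q - 1) - m points;
-- the missing size 3q - 4 is reached with σ = 1, τ = 0, m = 2.  Every line meets B, and no line lies in B,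
-- since an affine line z = a y + c with a, c ≠ 0 has only three points on the axes and the diagonal while
-- q ≥ 5.  Every point of B has a tangent: a horizontal or vertical line, a line through the origin, or a
-- line of slope 1, which misses the rest of B because the diagonal parameters contain ± 1 (and, when
-- m = 2, are closed under negation).  Hence B is minimal.  At P₀ = (1 : 0 : z) with ι z = q - 1 the
-- horizontal line is the only tangent: every other line through P₀ meets B again in a direction, on the
-- y-axis or on the z-axis.

open import Algebra.Bundles using (CommutativeRing)
open import Data.Empty using (⊥)
open import Data.Fin as Fin using (Fin)
import Data.Fin.Properties as Fin
open import Data.Integer as ℤ using (ℤ; +_; -[1+_]; _⊖_; 0ℤ; 1ℤ)
import Data.Integer.Properties as ℤ
open import Data.Maybe using (Maybe; just; nothing)
open import Data.Nat as ℕ using (ℕ; zero; suc; _≤_; _<_; z≤n; s≤s)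
import Data.Nat.Properties as ℕ
open import Data.Nat.Tactic.RingSolver using (solve-∀)
open import Data.Product using (∃; ∃-syntax; _×_; _,_; proj₁; proj₂)
open import Data.Sum using (_⊎_; inj₁; inj₂; [_,_])
open import Data.Unit using (tt)
open import Function using (_∘_)
open import Relation.Binary.PropositionalEquality as ≡ using (_≡_; _≢_)
open import Relation.Nullary using (¬_; Dec; yes; no)
open import Relation.Nullary.Negation using (contradiction)

open import Defs

module IntegerCoefficients {c ℓ} (R : CommutativeRing c ℓ) where
  open CommutativeRing R
  open import Algebra.Properties.Ring ring using (-‿distribˡ-*; -‿distribʳ-*; -0#≈0#; -‿involutive; -‿+-comm)
  -- In the TC-optimised multiple 1 ⋆ 1# reduces to 1#, so the solver's con 1ℤ is 1# on the nose.
  open import Algebra.Properties.Semiring.Mult.TCOptimised semiring using (1+×; ×-homo-+; ×1-homo-*) renaming (_×_ to _⋆_)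
  open import Relation.Binary.Reasoning.Setoid setoid
  import Algebra.Solver.Ring.AlmostCommutativeRing as ACR

  fromℤ : ℤ → Carrier
  fromℤ (+ n)      = n ⋆ 1#
  fromℤ -[1+ n ]   = - (suc n ⋆ 1#)

  fromℤ-⊖ : ∀ m n → fromℤ (m ⊖ n) ≈ m ⋆ 1# - n ⋆ 1#
  fromℤ-⊖ m       zero    = sym (trans (+-congˡ -0#≈0#) (+-identityʳ _))
  fromℤ-⊖ zero    (suc n) = sym (+-identityˡ _)
  fromℤ-⊖ (suc m) (suc n) = begin
    fromℤ (suc m ⊖ suc n)                    ≡⟨ ≡.cong fromℤ (ℤ.[1+m]⊖[1+n]≡m⊖n m n) ⟩
    fromℤ (m ⊖ n)                            ≈⟨ fromℤ-⊖ m n ⟩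
    m ⋆ 1# - n ⋆ 1#                      ≈⟨ sym (+-cancel-1# (m ⋆ 1#) (n ⋆ 1#)) ⟩
    (1# + m ⋆ 1#) - (1# + n ⋆ 1#)        ≈⟨ +-cong (1+× m 1#) (-‿cong (1+× n 1#)) ⟨
    suc m ⋆ 1# - suc n ⋆ 1#              ∎
    where
    +-cancel-1# : ∀ a b → (1# + a) - (1# + b) ≈ a - b
    +-cancel-1# a b = begin
      (1# + a) + - (1# + b)    ≈⟨ +-congˡ (sym (-‿+-comm 1# b)) ⟩
      (1# + a) + (- 1# + - b)  ≈⟨ sym (+-assoc _ _ _) ⟩
      ((1# + a) + - 1#) + - b  ≈⟨ +-congʳ (+-congʳ (+-comm 1# a)) ⟩
      ((a + 1#) + - 1#) + - b  ≈⟨ +-congʳ (+-assoc _ _ _) ⟩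
      (a + (1# + - 1#)) + - b  ≈⟨ +-congʳ (+-congˡ (-‿inverseʳ 1#)) ⟩
      (a + 0#) + - b           ≈⟨ +-congʳ (+-identityʳ a) ⟩
      a - b                    ∎

  fromℤ-+ : ∀ i j → fromℤ (i ℤ.+ j) ≈ fromℤ i + fromℤ j
  fromℤ-+ (+ m)    (+ n)    = ×-homo-+ 1# m n
  fromℤ-+ (+ m)    -[1+ n ] = fromℤ-⊖ m (suc n)
  fromℤ-+ -[1+ m ] (+ n)    = trans (fromℤ-⊖ n (suc m)) (+-comm _ _)
  fromℤ-+ -[1+ m ] -[1+ n ] = begin
    - (suc (suc (m ℕ.+ n)) ⋆ 1#)       ≡⟨ ≡.cong (λ k → - (suc k ⋆ 1#)) (ℕ.+-suc m n) ⟨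
    - ((suc m ℕ.+ suc n) ⋆ 1#)         ≈⟨ -‿cong (×-homo-+ 1# (suc m) (suc n)) ⟩
    - (suc m ⋆ 1# + suc n ⋆ 1#)        ≈⟨ -‿+-comm _ _ ⟨
    - (suc m ⋆ 1#) + - (suc n ⋆ 1#)    ∎

  fromℤ-* : ∀ i j → fromℤ (i ℤ.* j) ≈ fromℤ i * fromℤ j
  fromℤ-* (+ zero)  j         = sym (zeroˡ _)
  fromℤ-* i         (+ zero)  = trans (reflexive (≡.cong fromℤ (ℤ.*-zeroʳ i))) (sym (zeroʳ _))
  fromℤ-* (+ suc m) (+ suc n) = ×1-homo-* (suc m) (suc n)
  fromℤ-* (+ suc m) -[1+ n ]  = trans (-‿cong (×1-homo-* (suc m) (suc n))) (-‿distribʳ-* _ _)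
  fromℤ-* -[1+ m ]  (+ suc n) = trans (-‿cong (×1-homo-* (suc m) (suc n))) (-‿distribˡ-* _ _)
  fromℤ-* -[1+ m ]  -[1+ n ]  = begin
    (suc m ℕ.* suc n) ⋆ 1#             ≈⟨ ×1-homo-* (suc m) (suc n) ⟩
    suc m ⋆ 1# * suc n ⋆ 1#            ≈⟨ *-congʳ (-‿involutive _) ⟨
    - - (suc m ⋆ 1#) * suc n ⋆ 1#      ≈⟨ -‿distribˡ-* _ _ ⟨
    - (- (suc m ⋆ 1#) * suc n ⋆ 1#)    ≈⟨ -‿distribʳ-* _ _ ⟩
    - (suc m ⋆ 1#) * - (suc n ⋆ 1#)    ∎

  fromℤ-neg : ∀ i → fromℤ (ℤ.- i) ≈ - fromℤ i
  fromℤ-neg (+ zero)  = sym -0#≈0#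
  fromℤ-neg (+ suc n) = refl
  fromℤ-neg -[1+ n ]  = sym (-‿involutive _)

  fromℤ-morphism : ℤ.+-*-rawRing ACR.-Raw-AlmostCommutative⟶ ACR.fromCommutativeRing R
  fromℤ-morphism = record
    { ⟦_⟧ = fromℤ ; +-homo = fromℤ-+ ; *-homo = fromℤ-* ; -‿homo = fromℤ-neg
    ; 0-homo = refl ; 1-homo = refl }

  _≟-coefficient_ : ∀ i j → Maybe (fromℤ i ≈ fromℤ j)
  i ≟-coefficient j with i ℤ.≟ j
  ... | yes ≡.refl = just refl
  ... | no _       = nothing

  open import Algebra.Solver.Ring ℤ.+-*-rawRing (ACR.fromCommutativeRing R) fromℤ-morphism _≟-coefficient_ public

module FieldProperties {q} (F : FiniteField q) where
  open FiniteField F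
  open IntegerCoefficients cring public using (solve; _:=_; _:+_; _:*_; :-_; _:-_; con)
  open import Algebra.Properties.Group +-group public using (x∙y⁻¹≈ε⇒x≈y; x≈y⇒x∙y⁻¹≈ε)
  open import Algebra.Properties.Ring ring public using (-0#≈0#; -‿involutive)
  open import Relation.Binary.Reasoning.Setoid setoid

  infix 4 _≟_
  _≟_ : ∀ x y → Dec (x ≈ y)
  x ≟ y with enum-sur x | enum-sur y
  ... | i , eᵢ≈x | j , eⱼ≈y with i Fin.≟ j
  ... | yes ≡.refl = yes (trans (sym eᵢ≈x) eⱼ≈y)
  ... | no i≢j     = no (λ x≈y → i≢j (enum-inj i j (trans eᵢ≈x (trans x≈y (sym eⱼ≈y)))))

  infix 9 _⁻¹
  _⁻¹ : Carrier → Carrier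
  x ⁻¹ with x ≟ 0#
  ... | yes _   = 0#
  ... | no x≉0 = proj₁ (inverse x x≉0)

  ⁻¹-inverseʳ : ∀ {x} → x ≉ 0# → x * x ⁻¹ ≈ 1#
  ⁻¹-inverseʳ {x} x≉0 with x ≟ 0#
  ... | yes x≈0 = contradiction x≈0 x≉0
  ... | no x≉0′ = proj₂ (inverse x x≉0′)

  ⁻¹-inverseˡ : ∀ {x} → x ≉ 0# → x ⁻¹ * x ≈ 1#
  ⁻¹-inverseˡ x≉0 = trans (*-comm _ _) (⁻¹-inverseʳ x≉0)

  x*y≈z⇒y≈x⁻¹*z : ∀ {x y z} → x ≉ 0# → x * y ≈ z → y ≈ x ⁻¹ * z
  x*y≈z⇒y≈x⁻¹*z {x} {y} {z} x≉0 xy≈z = begin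
    y               ≈⟨ *-identityˡ y ⟨
    1# * y          ≈⟨ *-congʳ (⁻¹-inverseˡ x≉0) ⟨
    x ⁻¹ * x * y    ≈⟨ *-assoc _ _ _ ⟩
    x ⁻¹ * (x * y)  ≈⟨ *-congˡ xy≈z ⟩
    x ⁻¹ * z        ∎

  x*y≈0⇒y≈0 : ∀ {x y} → x ≉ 0# → x * y ≈ 0# → y ≈ 0#
  x*y≈0⇒y≈0 x≉0 xy≈0 = trans (x*y≈z⇒y≈x⁻¹*z x≉0 xy≈0) (zeroʳ _)

  ⁻¹-≉0 : ∀ {x} → x ≉ 0# → x ⁻¹ ≉ 0#
  ⁻¹-≉0 {x} x≉0 x⁻¹≈0 = 1≉0 (trans (sym (⁻¹-inverseʳ x≉0)) (trans (*-congˡ x⁻¹≈0) (zeroʳ x)))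

  -‿≈0 : ∀ {x} → x ≈ 0# → - x ≈ 0#
  -‿≈0 x≈0 = trans (-‿cong x≈0) -0#≈0#

  -‿≉0 : ∀ {x} → x ≉ 0# → - x ≉ 0#
  -‿≉0 {x} x≉0 -x≈0 = x≉0 (trans (sym (-‿involutive x)) (-‿≈0 -x≈0))

  exists-avoiding : ∀ {k} → k < q → (f : Fin k → Carrier) → ∃[ x ] (∀ i → x ≉ f i)
  exists-avoiding {k} k<q f with Fin.all? (λ j → Fin.any? (λ i → enum j ≟ f i))
  ... | no ¬covered =
    let j , ¬hit = Fin.¬∀⟶∃¬ q _ (λ j → Fin.any? (λ i → enum j ≟ f i)) ¬covered
    in enum j , λ i eⱼ≈fᵢ → ¬hit (i , eⱼ≈fᵢ)
  ... | yes covered =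
    let j₁ , j₂ , j₁<j₂ , same = Fin.pigeonhole k<q (λ j → proj₁ (covered j))
    in contradiction (enum-inj j₁ j₂ (trans (proj₂ (covered j₁)) (trans (reflexive (≡.cong f same)) (sym (proj₂ (covered j₂))))))
                     (Fin.<⇒≢ j₁<j₂)

  record Enumeration (A : Carrier → Set) (k : ℕ) : Set where
    field
      element   : Fin k → Carrier
      injective : ∀ i j → element i ≈ element j → i ≡ j
      sound     : ∀ i → A (element i)
      complete  : ∀ x → A x → ∃[ i ] element i ≈ x

module Indexings {q} (F : FiniteField q) where
  open FiniteField F
  open FieldProperties F
  open import Function.Bundles using (Inverse)
  import Function.Construct.Composition as Compose
  open import Data.Fin.Permutation using (transpose)
  open import Relation.Nullary.Decidable using (dec-true; dec-false)
  open Inverse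

  Indexing : Set
  Indexing = Inverse setoid (≡.setoid (Fin q))

  enumeration : Indexing
  enumeration = record
    { to        = λ x → proj₁ (enum-sur x)
    ; from      = enum
    ; to-cong   = λ {x} {y} x≈y → enum-inj _ _ (trans (proj₂ (enum-sur x)) (trans x≈y (sym (proj₂ (enum-sur y)))))
    ; from-cong = λ i≡j → reflexive (≡.cong enum i≡j)
    ; inverse   = (λ {i} {x} x≈eᵢ → enum-inj _ _ (trans (proj₂ (enum-sur x)) x≈eᵢ))
                , (λ {x} {i} i≡ → trans (reflexive (≡.cong enum i≡)) (proj₂ (enum-sur x)))
    }

  to-injective : ∀ (I : Indexing) {x y} → to I x ≡ to I y → x ≈ y
  to-injective I {x} {y} eq = trans (sym (strictlyInverseʳ I x)) (trans (from-cong I eq) (strictlyInverseʳ I y))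

  place : Fin q → Carrier → Indexing → Indexing
  place p c I = Compose.inverse I (transpose (to I c) p)

  place-at : ∀ p c I → to (place p c I) c ≡ p
  place-at p c I rewrite dec-true (to I c Fin.≟ to I c) ≡.refl = ≡.refl

  place-elsewhere : ∀ {p c x} I → to I x ≢ p → x ≉ c → to (place p c I) x ≡ to I x
  place-elsewhere {p} {c} {x} I ≢p x≉c
    rewrite dec-false (to I x Fin.≟ to I c) (λ eq → x≉c (to-injective I eq))
          | dec-false (to I x Fin.≟ p) ≢p = ≡.refl

module StandardIndexing {n} (F : FiniteField (3 ℕ.+ n)) where
  open FiniteField F
  open FieldProperties F
  open import Relation.Binary.Reasoning.Setoid setoid
  open Indexings F
  open import Function.Bundles using (Inverse)
  open Inverse

  0F 1F 2F : Fin (3 ℕ.+ n)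
  0F = Fin.zero
  1F = Fin.suc Fin.zero
  2F = Fin.suc (Fin.suc Fin.zero)

  -- Placing - 1# before 1# makes the case - 1# ≈ 1# harmless.
  private
    I₂ I₁ : Indexing
    I₂ = place 2F (- 1#) enumeration
    I₁ = place 1F 1# I₂

  standard : Indexing
  standard = place 0F 0# I₁

  ι : Carrier → ℕ
  ι x = Fin.toℕ (to standard x)

  ι-cong : ∀ {x y} → x ≈ y → ι x ≡ ι y
  ι-cong x≈y = ≡.cong Fin.toℕ (to-cong standard x≈y)

  ι-injective : ∀ {x y} → ι x ≡ ι y → x ≈ y
  ι-injective eq = to-injective standard (Fin.toℕ-injective eq)

  ι-0# : ι 0# ≡ 0
  ι-0# = ≡.cong Fin.toℕ (place-at 0F 0# I₁)

  ι-1# : ι 1# ≡ 1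
  ι-1# = ≡.cong Fin.toℕ (≡.trans (place-elsewhere I₁ (λ eq → 1≢0 (≡.trans (≡.sym at₁) eq)) 1≉0) at₁)
    where
    1≢0 : 1F ≢ 0F
    1≢0 ()
    at₁ : to I₁ 1# ≡ 1F
    at₁ = place-at 1F 1# I₂

  ι≡1⇒≈1 : ∀ {x} → ι x ≡ 1 → x ≈ 1#
  ι≡1⇒≈1 eq = ι-injective (≡.trans eq (≡.sym ι-1#))

  ι-‿1# : - 1# ≉ 1# → ι (- 1#) ≡ 2
  ι-‿1# -1≉1 = ≡.cong Fin.toℕ (≡.trans (place-elsewhere I₁ (λ eq → 2≢0 (≡.trans (≡.sym at₁) eq)) (-‿≉0 1≉0)) at₁)
    where
    2≢0 : 2F ≢ 0F
    2≢0 ()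
    2≢1 : 2F ≢ 1F
    2≢1 ()
    at₂ : to I₂ (- 1#) ≡ 2F
    at₂ = place-at 2F (- 1#) enumeration
    at₁ : to I₁ (- 1#) ≡ 2F
    at₁ = ≡.trans (place-elsewhere I₂ (λ eq → 2≢1 (≡.trans (≡.sym at₂) eq)) -1≉1) at₂

  ι-‿1#≤2 : ι (- 1#) ≤ 2
  ι-‿1#≤2 with - 1# ≟ 1#
  ... | yes -1≈1 = ≡.subst (_≤ 2) (≡.sym (≡.trans (ι-cong -1≈1) ι-1#)) (s≤s z≤n)
  ... | no  -1≉1 = ℕ.≤-reflexive (ι-‿1# -1≉1)

  ι-‿≤2 : ∀ {t} → 0 < ι t → ι t ≤ 2 → ι (- t) ≤ 2
  ι-‿≤2 {t} 0<ιt ιt≤2 with ι t in eq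
  ... | 1 = ≡.subst (_≤ 2) (ι-cong (-‿cong (sym (ι≡1⇒≈1 eq)))) ι-‿1#≤2
  ... | 2 with - 1# ≟ 1#
  ...   | yes -1≈1 = ≡.subst (_≤ 2) (≡.trans (≡.sym eq) (ι-cong -t≈t)) ℕ.≤-refl
    where
    -t≈t : t ≈ - t
    -t≈t = sym (begin
      - t          ≈⟨ solve 1 (λ t → :- t := :- con 1ℤ :* t) refl t ⟩
      - 1# * t     ≈⟨ *-congʳ -1≈1 ⟩
      1# * t       ≈⟨ *-identityˡ t ⟩
      t            ∎)
  ...   | no -1≉1 = ≡.subst (_≤ 2) (≡.sym (≡.trans (ι-cong -t≈1) ι-1#)) (s≤s z≤n)
    where
    -t≈1 : - t ≈ 1#
    -t≈1 = trans (-‿cong (ι-injective (≡.trans eq (≡.sym (ι-‿1# -1≉1))))) (-‿involutive 1#)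
  ι-‿≤2 {t} 0<ιt (s≤s (s≤s ())) | suc (suc (suc _))

  ι⁻¹ : ∀ {i} → i < 3 ℕ.+ n → Carrier
  ι⁻¹ i<q = from standard (Fin.fromℕ< i<q)

  ι-ι⁻¹ : ∀ {i} (i<q : i < 3 ℕ.+ n) → ι (ι⁻¹ i<q) ≡ i
  ι-ι⁻¹ i<q = ≡.trans (≡.cong Fin.toℕ (strictlyInverseˡ standard _)) (Fin.toℕ-fromℕ< i<q)

  <ι⇒≉0 : ∀ {x k} → k < ι x → x ≉ 0#
  <ι⇒≉0 k<ιx x≈0 = ℕ.n≮0 (≡.subst (_ <_) (≡.trans (ι-cong x≈0) ι-0#) k<ιx)

  ι<q : ∀ x → ι x < 3 ℕ.+ n
  ι<q x = Fin.toℕ<n (to standard x)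

  ≉0⇒0<ι : ∀ {x} → x ≉ 0# → 0 < ι x
  ≉0⇒0<ι {x} x≉0 with ι x in eq
  ... | zero  = contradiction (ι-injective (≡.trans eq (≡.sym ι-0#))) x≉0
  ... | suc _ = s≤s z≤n

  interval : ∀ a k → a ℕ.+ k < 3 ℕ.+ n → Enumeration (λ x → a < ι x × ι x ≤ a ℕ.+ k) k
  interval a k a+k<q = record
    { element   = element
    ; injective = λ i j eq → Fin.toℕ-injective (ℕ.+-cancelˡ-≡ (suc a) _ _
                    (≡.trans (≡.sym (ι-element i)) (≡.trans (ι-cong eq) (ι-element j))))
    ; sound     = λ j → ≡.subst (λ i → a < i × i ≤ a ℕ.+ k) (≡.sym (ι-element j))
                    (s≤s (ℕ.m≤m+n a _) , ℕ.+-monoʳ-< a (Fin.toℕ<n j))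
    ; complete  = complete
    }
    where
    bound : (j : Fin k) → suc a ℕ.+ Fin.toℕ j < 3 ℕ.+ n
    bound j = ℕ.≤-<-trans (ℕ.+-monoʳ-< a (Fin.toℕ<n j)) a+k<q
    element : Fin k → Carrier
    element j = ι⁻¹ (bound j)
    ι-element : ∀ j → ι (element j) ≡ suc a ℕ.+ Fin.toℕ j
    ι-element j = ι-ι⁻¹ (bound j)
    complete : ∀ x → a < ι x × ι x ≤ a ℕ.+ k → ∃[ j ] element j ≈ x
    complete x (a<ιx , ιx≤a+k) =
      j , ι-injective (≡.trans (ι-element j) (≡.trans (≡.cong (suc a ℕ.+_) (Fin.toℕ-fromℕ< j<k)) (ℕ.m+[n∸m]≡n a<ιx)))
      where
      j<k : ι x ℕ.∸ suc a < k
      j<k = ℕ.+-cancelˡ-< (suc a) _ _ (≡.subst (_< suc a ℕ.+ k) (≡.sym (ℕ.m+[n∸m]≡n a<ιx)) (s≤s ιx≤a+k))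
      j : Fin k
      j = Fin.fromℕ< j<k

  above : ∀ a → a ≤ 2 ℕ.+ n → Enumeration (λ x → a < ι x) (2 ℕ.+ n ℕ.∸ a)
  above a a≤2+n = record
    { element   = element
    ; injective = injective
    ; sound     = λ j → proj₁ (sound j)
    ; complete  = λ x a<ιx → complete x (a<ιx , ≡.subst (ι x ℕ.≤_) (≡.sym a+k≡2+n) (ℕ.<⇒≤pred (ι<q x)))
    }
    where
    a+k≡2+n : a ℕ.+ (2 ℕ.+ n ℕ.∸ a) ≡ 2 ℕ.+ n
    a+k≡2+n = ℕ.m+[n∸m]≡n a≤2+n
    open Enumeration (interval a (2 ℕ.+ n ℕ.∸ a) (≡.subst (_< 3 ℕ.+ n) (≡.sym a+k≡2+n) ℕ.≤-refl))

pattern aff y z = inj₁ (y , z)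
pattern dir s   = inj₂ (inj₁ s)
pattern dir∞    = inj₂ (inj₂ tt)

module Plane {q} (F : FiniteField q) where
  open FiniteField F
  open FieldProperties F
  open PG F
  open Triple
  open import Relation.Binary.Reasoning.Setoid setoid

  ≈P-refl : ∀ {P} → P ≈P P
  ≈P-refl = refl , refl , refl

  ≈P-sym : ∀ {P Q} → P ≈P Q → Q ≈P P
  ≈P-sym (x≈ , y≈ , z≈) = sym x≈ , sym y≈ , sym z≈

  ≈P-trans : ∀ {P Q R} → P ≈P Q → Q ≈P R → P ≈P R
  ≈P-trans (x≈ , y≈ , z≈) (x≈′ , y≈′ , z≈′) = trans x≈ x≈′ , trans y≈ y≈′ , trans z≈ z≈′

  on-respˡ : ∀ {P Q L} → P ≈P Q → P on L → Q on L
  on-respˡ (x≈ , y≈ , z≈) P∈L = trans (sym (+-cong (+-cong (*-congˡ x≈) (*-congˡ y≈)) (*-congˡ z≈))) P∈L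

  -- In homogeneous coordinates (x : y : z): x = 0, y = c x and z = a y + c x.
  data Equation : Set where
    atInfinity : Equation
    vertical   : Carrier → Equation
    graph      : Carrier → Carrier → Equation

  lhs rhs : Equation → Triple → Carrier
  lhs atInfinity   t = c₁ t
  lhs (vertical c) t = c₂ t
  lhs (graph a c)  t = c₃ t
  rhs atInfinity   t = 0#
  rhs (vertical c) t = c * c₁ t
  rhs (graph a c)  t = a * c₂ t + c * c₁ t

  _satisfies_ : Point → Equation → Set
  P satisfies e = lhs e (coords P) ≈ rhs e (coords P)

  module _ {a c : Carrier} where

    aff-graph⁻ : ∀ {y z} → aff y z satisfies graph a c → z ≈ a * y + c
    aff-graph⁻ sat = trans sat (+-congˡ (*-identityʳ c))

    aff-graph⁺ : ∀ {y z} → z ≈ a * y + c → aff y z satisfies graph a c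
    aff-graph⁺ eq = trans eq (+-congˡ (sym (*-identityʳ c)))

    dir-graph⁻ : ∀ {s} → dir s satisfies graph a c → s ≈ a
    dir-graph⁻ sat = trans sat (trans (+-cong (*-identityʳ a) (zeroʳ c)) (+-identityʳ a))

    dir-graph⁺ : ∀ {s} → s ≈ a → dir s satisfies graph a c
    dir-graph⁺ eq = trans eq (sym (trans (+-cong (*-identityʳ a) (zeroʳ c)) (+-identityʳ a)))

  module _ {c : Carrier} where

    aff-vertical⁻ : ∀ {y z} → aff y z satisfies vertical c → y ≈ c
    aff-vertical⁻ sat = trans sat (*-identityʳ c)

    aff-vertical⁺ : ∀ {y z} → y ≈ c → aff y z satisfies vertical c
    aff-vertical⁺ eq = trans eq (sym (*-identityʳ c))

    dir-vertical⁻ : ∀ {s} → ¬ dir s satisfies vertical c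
    dir-vertical⁻ sat = 1≉0 (trans sat (zeroʳ c))

    dir∞-vertical⁺ : dir∞ satisfies vertical c
    dir∞-vertical⁺ = sym (zeroʳ c)

  satisfies-resp : ∀ e {P Q} → P ≈P Q → P satisfies e → Q satisfies e
  satisfies-resp atInfinity   (x≈ , _ , _)     sat = trans (sym x≈) sat
  satisfies-resp (vertical c) (x≈ , y≈ , _)    sat = trans (sym y≈) (trans sat (*-congˡ x≈))
  satisfies-resp (graph a c)  (x≈ , y≈ , z≈)   sat = trans (sym z≈) (trans sat (+-cong (*-congˡ y≈) (*-congˡ x≈)))

  record _HasEquation_ (L : Line) (e : Equation) : Set where
    field
      on⇒satisfies : ∀ P → P on L → P satisfies e
      satisfies⇒on : ∀ P → P satisfies e → P on L
  open _HasEquation_ public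

  infix 7 _·_
  _·_ : Triple → Triple → Carrier
  ⟨ a , b , c ⟩ · ⟨ x , y , z ⟩ = a * x + b * y + c * z

  coefficients : Equation → Triple
  coefficients atInfinity   = ⟨ 1# , 0# , 0# ⟩
  coefficients (vertical c) = ⟨ - c , 1# , 0# ⟩
  coefficients (graph a c)  = ⟨ - c , - a , 1# ⟩

  lhs-rhs : ∀ e t → lhs e t - rhs e t ≈ coefficients e · t
  lhs-rhs atInfinity   ⟨ x , y , z ⟩ =
    solve 3 (λ x y z → x :- con 0ℤ := con 1ℤ :* x :+ con 0ℤ :* y :+ con 0ℤ :* z) refl x y z
  lhs-rhs (vertical c) ⟨ x , y , z ⟩ =
    solve 4 (λ c x y z → y :- c :* x := :- c :* x :+ con 1ℤ :* y :+ con 0ℤ :* z) refl c x y z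
  lhs-rhs (graph a c)  ⟨ x , y , z ⟩ =
    solve 5 (λ a c x y z → z :- (a :* y :+ c :* x) := :- c :* x :+ :- a :* y :+ con 1ℤ :* z) refl a c x y z

  ·-scaleˡ : ∀ k u t → ⟨ k * c₁ u , k * c₂ u , k * c₃ u ⟩ · t ≈ k * (u · t)
  ·-scaleˡ k ⟨ a , b , c ⟩ ⟨ x , y , z ⟩ =
    solve 7 (λ k a b c x y z → k :* a :* x :+ k :* b :* y :+ k :* c :* z := k :* (a :* x :+ b :* y :+ c :* z)) refl k a b c x y z

  infix 4 _∼_
  _∼_ : Triple → Triple → Set
  ⟨ a , b , c ⟩ ∼ ⟨ a′ , b′ , c′ ⟩ = ∃[ k ] (k ≉ 0# × k * a ≈ a′ × k * b ≈ b′ × k * c ≈ c′)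

  proportional⇒has-equation : ∀ L e → coords L ∼ coefficients e → L HasEquation e
  proportional⇒has-equation L e (k , k≉0 , a≈ , b≈ , c≈) = record
    { on⇒satisfies = λ P P∈L → x∙y⁻¹≈ε⇒x≈y _ _ (trans (scaled (coords P)) (trans (*-congˡ P∈L) (zeroʳ k)))
    ; satisfies⇒on = λ P sat → x*y≈0⇒y≈0 k≉0 (trans (sym (scaled (coords P))) (x≈y⇒x∙y⁻¹≈ε sat))
    }
    where
    scaled : ∀ t → lhs e t - rhs e t ≈ k * (coords L · t)
    scaled t = begin
      lhs e t - rhs e t                                                  ≈⟨ lhs-rhs e t ⟩
      coefficients e · t                                                 ≈⟨ +-cong (+-cong (*-congʳ a≈) (*-congʳ b≈)) (*-congʳ c≈) ⟨
      ⟨ k * c₁ (coords L) , k * c₂ (coords L) , k * c₃ (coords L) ⟩ · t  ≈⟨ ·-scaleˡ k (coords L) t ⟩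
      k * (coords L · t)                                                 ∎

  -x*-x⁻¹≈1 : ∀ {x} → x ≉ 0# → - x * - x ⁻¹ ≈ 1#
  -x*-x⁻¹≈1 {x} x≉0 = trans (solve 2 (λ x w → :- x :* :- w := x :* w) refl x (x ⁻¹)) (⁻¹-inverseʳ x≉0)

  lineOf : Equation → Line
  lineOf atInfinity = inj₁ (0# , 0#)
  lineOf (vertical c) with c ≟ 0#
  ... | yes _ = inj₂ (inj₁ 0#)
  ... | no  _ = inj₁ (- c ⁻¹ , 0#)
  lineOf (graph a c) with c ≟ 0# | a ≟ 0#
  ... | no  _ | _     = inj₁ (a * c ⁻¹ , - c ⁻¹)
  ... | yes _ | no  _ = inj₂ (inj₁ (- a ⁻¹))
  ... | yes _ | yes _ = inj₂ (inj₂ tt)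

  lineOf-equation : ∀ e → lineOf e HasEquation e
  lineOf-equation atInfinity = proportional⇒has-equation _ atInfinity
    (1# , 1≉0 , *-identityˡ 1# , zeroʳ 1# , zeroʳ 1#)
  lineOf-equation (vertical c) with c ≟ 0#
  ... | yes c≈0 = proportional⇒has-equation _ (vertical c)
    (1# , 1≉0 , trans (zeroʳ 1#) (sym (-‿≈0 c≈0)) , *-identityˡ 1# , zeroʳ 1#)
  ... | no c≉0  = proportional⇒has-equation _ (vertical c)
    (- c , -‿≉0 c≉0 , *-identityʳ (- c) , -x*-x⁻¹≈1 c≉0 , zeroʳ (- c))
  lineOf-equation (graph a c) with c ≟ 0# | a ≟ 0#
  ... | no c≉0  | _       = proportional⇒has-equation _ (graph a c)
    (- c , -‿≉0 c≉0 , *-identityʳ (- c) , -c*ac⁻¹≈-a , -x*-x⁻¹≈1 c≉0)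
    where
    -c*ac⁻¹≈-a : - c * (a * c ⁻¹) ≈ - a
    -c*ac⁻¹≈-a = begin
      - c * (a * c ⁻¹)   ≈⟨ solve 3 (λ a c w → :- c :* (a :* w) := :- (c :* w :* a)) refl a c (c ⁻¹) ⟩
      - (c * c ⁻¹ * a)   ≈⟨ -‿cong (trans (*-congʳ (⁻¹-inverseʳ c≉0)) (*-identityˡ a)) ⟩
      - a                ∎
  ... | yes c≈0 | no a≉0  = proportional⇒has-equation _ (graph a c)
    (- a , -‿≉0 a≉0 , trans (zeroʳ (- a)) (sym (-‿≈0 c≈0)) , *-identityʳ (- a) , -x*-x⁻¹≈1 a≉0)
  ... | yes c≈0 | yes a≈0 = proportional⇒has-equation _ (graph a c)
    (1# , 1≉0 , trans (zeroʳ 1#) (sym (-‿≈0 c≈0)) , trans (zeroʳ 1#) (sym (-‿≈0 a≈0)) ,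
     *-identityˡ 1#)

  line-equation : ∀ L → ∃[ e ] L HasEquation e
  line-equation L@(inj₁ (b , c)) with c ≟ 0# | b ≟ 0#
  ... | no c≉0  | _       = graph (- (c ⁻¹ * b)) (- c ⁻¹) , proportional⇒has-equation L _
    (c ⁻¹ , ⁻¹-≉0 c≉0 , trans (*-identityʳ _) (sym (-‿involutive _)) , sym (-‿involutive _) , ⁻¹-inverseˡ c≉0)
  ... | yes c≈0 | no b≉0  = vertical (- b ⁻¹) , proportional⇒has-equation L _
    (b ⁻¹ , ⁻¹-≉0 b≉0 , trans (*-identityʳ _) (sym (-‿involutive _)) , ⁻¹-inverseˡ b≉0 , trans (*-congˡ c≈0) (zeroʳ _))
  ... | yes c≈0 | yes b≈0 = atInfinity , proportional⇒has-equation L _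
    (1# , 1≉0 , *-identityˡ 1# , trans (*-identityˡ b) b≈0 , trans (*-identityˡ c) c≈0)
  line-equation L@(inj₂ (inj₁ c)) with c ≟ 0#
  ... | no c≉0  = graph (- c ⁻¹) 0# , proportional⇒has-equation L _
    (c ⁻¹ , ⁻¹-≉0 c≉0 , trans (zeroʳ _) (sym -0#≈0#) , trans (*-identityʳ _) (sym (-‿involutive _)) , ⁻¹-inverseˡ c≉0)
  ... | yes c≈0 = vertical 0# , proportional⇒has-equation L _
    (1# , 1≉0 , trans (zeroʳ 1#) (sym -0#≈0#) , *-identityˡ 1# , trans (*-identityˡ c) c≈0)
  line-equation L@(inj₂ (inj₂ tt)) = graph 0# 0# , proportional⇒has-equation L _
    (1# , 1≉0 , trans (zeroʳ 1#) (sym -0#≈0#) , trans (zeroʳ 1#) (sym -0#≈0#) , *-identityˡ 1#)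

  horizontal-coordinates : ∀ {y z} L → z ≉ 0# → dir 0# on L → aff y z on L → L ≈L inj₁ (0# , - z ⁻¹)
  horizontal-coordinates {y} {z} (inj₁ (b , c)) z≉0 dir∈L aff∈L = refl , b≈0 , c≈-z⁻¹
    where
    b≈0 : b ≈ 0#
    b≈0 = trans (solve 2 (λ b c → b := con 1ℤ :* con 0ℤ :+ b :* con 1ℤ :+ c :* con 0ℤ) refl b c) dir∈L
    cz≈-1 : c * z ≈ - 1#
    cz≈-1 = x∙y⁻¹≈ε⇒x≈y _ _ (begin
      c * z - - 1#                  ≈⟨ solve 4 (λ b c y z → c :* z :- :- con 1ℤ := con 1ℤ :* con 1ℤ :+ b :* y :+ c :* z :- b :* y) refl b c y z ⟩
      1# * 1# + b * y + c * z - b * y ≈⟨ +-cong aff∈L (-‿cong (trans (*-congʳ b≈0) (zeroˡ y))) ⟩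
      0# - 0#                       ≈⟨ -‿inverseʳ 0# ⟩
      0#                            ∎)
    c≈-z⁻¹ : c ≈ - z ⁻¹
    c≈-z⁻¹ = begin
      c                ≈⟨ *-identityʳ c ⟨
      c * 1#           ≈⟨ *-congˡ (⁻¹-inverseʳ z≉0) ⟨
      c * (z * z ⁻¹)   ≈⟨ *-assoc c z (z ⁻¹) ⟨
      c * z * z ⁻¹     ≈⟨ *-congʳ cz≈-1 ⟩
      - 1# * z ⁻¹      ≈⟨ solve 1 (λ w → :- con 1ℤ :* w := :- w) refl (z ⁻¹) ⟩
      - z ⁻¹           ∎
  horizontal-coordinates (inj₂ (inj₁ c)) z≉0 dir∈L aff∈L =
    contradiction (trans (solve 1 (λ c → con 1ℤ := con 0ℤ :* con 0ℤ :+ con 1ℤ :* con 1ℤ :+ c :* con 0ℤ) refl c) dir∈L) 1≉0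
  horizontal-coordinates {y} {z} (inj₂ (inj₂ tt)) z≉0 dir∈L aff∈L =
    contradiction (trans (solve 2 (λ y z → z := con 0ℤ :* con 1ℤ :+ con 0ℤ :* y :+ con 1ℤ :* z) refl y z) aff∈L) z≉0

  horizontal-unique : ∀ {y z L L′} → z ≉ 0# →
    dir 0# on L → aff y z on L → dir 0# on L′ → aff y z on L′ → L ≈L L′
  horizontal-unique {z = z} {L} {L′} z≉0 dir∈L aff∈L dir∈L′ aff∈L′ =
    ≈P-trans {L} {H} {L′} (horizontal-coordinates L z≉0 dir∈L aff∈L)
                          (≈P-sym {L′} {H} (horizontal-coordinates L′ z≉0 dir∈L′ aff∈L′))
    where
    H = inj₁ (0# , - z ⁻¹)

  _on?_ : ∀ P L → Dec (P on L)
  P on? L = _ ≟ 0#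

  infixr 6 _∪_
  _∪_ : PointSet → PointSet → PointSet
  (S ∪ T) P = S P ⊎ T P

  Image : (Carrier → Point) → (Carrier → Set) → PointSet
  Image f A P = ∃[ x ] (A x × f x ≈P P)

  Image-resp : ∀ f A P Q → P ≈P Q → Image f A P → Image f A Q
  Image-resp f A P Q P≈Q (x , Ax , fx≈P) = x , Ax , ≈P-trans {f x} {P} {Q} fx≈P P≈Q

  Image-disjoint : ∀ {A B} f g → (∀ x y → A x → B y → ¬ f x ≈P g y) → ∀ P → Image f A P → Image g B P → ⊥
  Image-disjoint f g apart P (x , Ax , fx≈P) (y , By , gy≈P) =
    apart x y Ax By (≈P-trans {f x} {P} {g y} fx≈P (≈P-sym {g y} {P} gy≈P))

  TangentAt : PointSet → Point → Line → Set
  TangentAt S P L = P on L × (∀ Q → Q on L → S Q → Q ≈P P)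

  TangentAt-resp : ∀ {S P P′ L} → P ≈P P′ → TangentAt S P L → TangentAt S P′ L
  TangentAt-resp {P = P} {P′} {L} P≈P′ (P∈L , only-P) =
    on-respˡ {P} {P′} {L} P≈P′ P∈L , λ Q Q∈L SQ → ≈P-trans {Q} {P} {P′} (only-P Q Q∈L SQ) P≈P′

  tangents⇒minimal : ∀ {S} → IsBlockingSet S → (∀ P → S P → ∃[ L ] TangentAt S P L) → IsMinimalBlockingSet S
  tangents⇒minimal blocking tangent = blocking , λ where
    S′ S′-resp S′⊆S (P , SP , P∉S′) S′-blocking →
      let L , P∈L , only-P = tangent P SP
          Q , Q∈L , S′Q    = proj₁ (S′-blocking L)
      in P∉S′ (S′-resp (only-P Q Q∈L (S′⊆S Q S′Q)) S′Q)

  Image-tangent : ∀ {S A} f → (∀ x → A x → ∃[ L ] TangentAt S (f x) L) → ∀ P → Image f A P → ∃[ L ] TangentAt S P L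
  Image-tangent {S} f tangent-at P (x , Ax , fx≈P) =
    let L , t = tangent-at x Ax in L , TangentAt-resp {S} {f x} {P} {L} fx≈P t

  secant⇒¬tangent : ∀ {S L} → Secant S L → ¬ Tangent S L
  secant⇒¬tangent (P₁ , P₂ , P₁∈L , SP₁ , P₂∈L , SP₂ , P₁≉P₂) (T , _ , _ , only-T) =
    P₁≉P₂ (≈P-trans {P₁} {T} {P₂} (only-T P₁ P₁∈L SP₁) (≈P-sym {P₂} {T} (only-T P₂ P₂∈L SP₂)))

  rInf-property : ∀ {S P L} → S P → TangentAt S P L →
    (∀ L′ → P on L′ → L′ ≈L L ⊎ Secant S L′) → RInfProperty S P
  rInf-property {S} {P} {L} SP (P∈L , only-P) others =
    SP , L , P∈L , (P , P∈L , SP , only-P) , unique , secant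
    where
    unique : ∀ L′ → P on L′ → Tangent S L′ → L′ ≈L L
    unique L′ P∈L′ tangent with others L′ P∈L′
    ... | inj₁ L′≈L  = L′≈L
    ... | inj₂ secnt = contradiction tangent (secant⇒¬tangent {S} {L′} secnt)
    secant : ∀ L′ → P on L′ → ¬ (L′ ≈L L) → Secant S L′
    secant L′ P∈L′ L′≉L with others L′ P∈L′
    ... | inj₁ L′≈L  = contradiction L′≈L L′≉L
    ... | inj₂ secnt = secnt

  HasSize-∪ : ∀ {S T a b} → HasSize S a → HasSize T b → (∀ P → S P → T P → ⊥) → HasSize (S ∪ T) (a ℕ.+ b)
  HasSize-∪ {S} {T} {a} {b} (Bₛ , distinctₛ , ⊆Bₛ , Bₛ⊆) (Bₜ , distinctₜ , ⊆Bₜ , Bₜ⊆) disjoint =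
    B , distinct , ⊆B , B⊆
    where
    B : Fin (a ℕ.+ b) → Point
    B i = [ Bₛ , Bₜ ] (Fin.splitAt a i)

    apart : ∀ i j → ¬ Bₛ i ≈P Bₜ j
    apart i j eq = disjoint (Bₛ i) (Bₛ⊆ (Bₛ i) (i , ≈P-refl {Bₛ i})) (Bₜ⊆ (Bₛ i) (j , ≈P-sym {Bₛ i} {Bₜ j} eq))

    distinct : Distinct B
    distinct i j eq with Fin.splitAt a i in split-i | Fin.splitAt a j in split-j
    ... | inj₁ i′ | inj₁ j′ = ≡.trans (≡.sym (Fin.splitAt⁻¹-↑ˡ split-i))
                                (≡.trans (≡.cong (Fin._↑ˡ b) (distinctₛ i′ j′ eq)) (Fin.splitAt⁻¹-↑ˡ split-j))
    ... | inj₂ i′ | inj₂ j′ = ≡.trans (≡.sym (Fin.splitAt⁻¹-↑ʳ split-i))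
                                (≡.trans (≡.cong (a Fin.↑ʳ_) (distinctₜ i′ j′ eq)) (Fin.splitAt⁻¹-↑ʳ split-j))
    ... | inj₁ i′ | inj₂ j′ = contradiction eq (apart i′ j′)
    ... | inj₂ i′ | inj₁ j′ = contradiction (≈P-sym {Bₜ i′} {Bₛ j′} eq) (apart j′ i′)

    ⊆B : ∀ P → (S ∪ T) P → SetOf B P
    ⊆B P (inj₁ SP) = let i , eq = ⊆Bₛ P SP in
      i Fin.↑ˡ b , ≡.subst (λ s → [ Bₛ , Bₜ ] s ≈P P) (≡.sym (Fin.splitAt-↑ˡ a i b)) eq
    ⊆B P (inj₂ TP) = let j , eq = ⊆Bₜ P TP in
      a Fin.↑ʳ j , ≡.subst (λ s → [ Bₛ , Bₜ ] s ≈P P) (≡.sym (Fin.splitAt-↑ʳ a b j)) eq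

    B⊆ : ∀ P → SetOf B P → (S ∪ T) P
    B⊆ P (i , eq) with Fin.splitAt a i
    ... | inj₁ i′ = inj₁ (Bₛ⊆ P (i′ , eq))
    ... | inj₂ j′ = inj₂ (Bₜ⊆ P (j′ , eq))

  HasSize-Image : ∀ {A k} (f : Carrier → Point) →
    (∀ {x y} → x ≈ y → f x ≈P f y) → (∀ {x y} → f x ≈P f y → x ≈ y) →
    Enumeration A k → HasSize (Image f A) k
  HasSize-Image {A} f f-cong f-injective enumeration =
    f ∘ element , (λ i j eq → injective i j (f-injective eq)) , ⊆B , B⊆
    where
    open Enumeration enumeration
    ⊆B : ∀ P → Image f A P → SetOf (f ∘ element) P
    ⊆B P (x , Ax , fx≈P) = let i , eᵢ≈x = complete x Ax in
      i , ≈P-trans {f (element i)} {f x} {P} (f-cong eᵢ≈x) fx≈P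
    B⊆ : ∀ P → SetOf (f ∘ element) P → Image f A P
    B⊆ P (i , eq) = element i , sound i , eq

data Shape : ℕ → ℕ → ℕ → Set where
  balanced : ∀ {m} → m ≢ 1 → Shape 0 m m
  skewed   : Shape 1 0 2

module _ {σ τ m : ℕ} where

  shape-σ≤1 : Shape σ τ m → σ ≤ 1
  shape-σ≤1 (balanced _) = z≤n
  shape-σ≤1 skewed       = s≤s z≤n

  shape-τ≤m : Shape σ τ m → τ ≤ m
  shape-τ≤m (balanced _) = ℕ.≤-refl
  shape-τ≤m skewed       = z≤n

  missing-slope⇒skewed : ∀ {i} → Shape σ τ m → 0 < i → i ≤ σ → i ≡ 1 × τ ≡ 0 × m ≡ 2
  missing-slope⇒skewed (balanced _) (s≤s _) ()
  missing-slope⇒skewed skewed (s≤s z≤n) (s≤s z≤n) = ≡.refl , ≡.refl , ≡.refl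

  short-y⇒skewed : ∀ {i} → Shape σ τ m → τ < i → i ≤ m → σ ≡ 1 × m ≡ 2
  short-y⇒skewed (balanced _) τ<i i≤τ = contradiction i≤τ (ℕ.<⇒≱ τ<i)
  short-y⇒skewed skewed       _   _   = ≡.refl , ≡.refl

  slope-one⇒balanced : Shape σ τ m → σ < 1 → 0 < m → τ ≡ m × 2 ≤ m
  slope-one⇒balanced (balanced m≢1) _ 0<m = ≡.refl , ℕ.≤∧≢⇒< 0<m (m≢1 ∘ ≡.sym)
  slope-one⇒balanced skewed (s≤s ()) _

size-formula : ℕ → ℕ → ℕ → ℕ → ℕ
size-formula n σ τ m = (4 ℕ.+ n ℕ.∸ σ) ℕ.+ ((4 ℕ.+ n ℕ.∸ τ) ℕ.+ ((4 ℕ.+ n ℕ.∸ m) ℕ.+ m))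

module Construction {n} (F : FiniteField (5 ℕ.+ n)) {σ τ m} (shape : Shape σ τ m) (m≤2+n : m ≤ 2 ℕ.+ n) where
  open FiniteField F
  open FieldProperties F
  open StandardIndexing {2 ℕ.+ n} F
  open PG F
  open Plane F
  open import Relation.Binary.Reasoning.Setoid setoid

  Slopes YAxis ZAxis Diagonal : Carrier → Set
  Slopes   s = σ < ι s
  YAxis    y = τ < ι y
  ZAxis    z = m < ι z
  Diagonal t = 0 < ι t × ι t ≤ m

  SlopePoints YAxisPoints ZAxisPoints DiagonalPoints B : PointSet
  SlopePoints    = Image dir Slopes
  YAxisPoints    = Image (λ y → aff y 0#) YAxis
  ZAxisPoints    = Image (λ z → aff 0# z) ZAxis
  DiagonalPoints = Image (λ t → aff t t) Diagonal
  B = SlopePoints ∪ YAxisPoints ∪ ZAxisPoints ∪ DiagonalPoints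

  data AffineMember (y z : Carrier) : Set where
    y-axis   : z ≈ 0# → τ < ι y → AffineMember y z
    z-axis   : y ≈ 0# → m < ι z → AffineMember y z
    diagonal : y ≈ z → 0 < ι y → ι y ≤ m → AffineMember y z

  B-aff⁻ : ∀ {y z} → B (aff y z) → AffineMember y z
  B-aff⁻ (inj₁ (_ , _ , 0≈1 , _)) = contradiction (sym 0≈1) 1≉0
  B-aff⁻ (inj₂ (inj₁ (y′ , τ<ιy′ , _ , y′≈y , 0≈z))) =
    y-axis (sym 0≈z) (≡.subst (τ <_) (ι-cong y′≈y) τ<ιy′)
  B-aff⁻ (inj₂ (inj₂ (inj₁ (z′ , m<ιz′ , _ , 0≈y , z′≈z)))) =
    z-axis (sym 0≈y) (≡.subst (m <_) (ι-cong z′≈z) m<ιz′)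
  B-aff⁻ (inj₂ (inj₂ (inj₂ (t , (0<ιt , ιt≤m) , _ , t≈y , t≈z)))) =
    diagonal (trans (sym t≈y) t≈z) (≡.subst (0 <_) (ι-cong t≈y) 0<ιt) (≡.subst (_≤ m) (ι-cong t≈y) ιt≤m)

  B-dir⁻ : ∀ {s} → B (dir s) → Slopes s
  B-dir⁻ (inj₁ (s′ , σ<ιs′ , _ , _ , s′≈s))       = ≡.subst (σ <_) (ι-cong s′≈s) σ<ιs′
  B-dir⁻ (inj₂ (inj₁ (_ , _ , 1≈0 , _)))           = contradiction 1≈0 1≉0
  B-dir⁻ (inj₂ (inj₂ (inj₁ (_ , _ , 1≈0 , _))))    = contradiction 1≈0 1≉0
  B-dir⁻ (inj₂ (inj₂ (inj₂ (_ , _ , 1≈0 , _))))    = contradiction 1≈0 1≉0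

  ¬B-dir∞ : ¬ B dir∞
  ¬B-dir∞ (inj₁ (_ , _ , _ , 1≈0 , _))            = 1≉0 1≈0
  ¬B-dir∞ (inj₂ (inj₁ (_ , _ , 1≈0 , _)))          = 1≉0 1≈0
  ¬B-dir∞ (inj₂ (inj₂ (inj₁ (_ , _ , 1≈0 , _))))   = 1≉0 1≈0
  ¬B-dir∞ (inj₂ (inj₂ (inj₂ (_ , _ , 1≈0 , _))))   = 1≉0 1≈0

  slope∈B : ∀ {s} → Slopes s → B (dir s)
  slope∈B h = inj₁ (_ , h , refl , refl , refl)

  y-axis∈B : ∀ {y} → YAxis y → B (aff y 0#)
  y-axis∈B h = inj₂ (inj₁ (_ , h , refl , refl , refl))

  z-axis∈B : ∀ {z} → ZAxis z → B (aff 0# z)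
  z-axis∈B h = inj₂ (inj₂ (inj₁ (_ , h , refl , refl , refl)))

  diagonal∈B : ∀ {t} → Diagonal t → B (aff t t)
  diagonal∈B h = inj₂ (inj₂ (inj₂ (_ , h , refl , refl , refl)))

  top<q : 4 ℕ.+ n < 5 ℕ.+ n
  top<q = ℕ.≤-refl

  top′<q : 3 ℕ.+ n < 5 ℕ.+ n
  top′<q = ℕ.n≤1+n _

  top top′ : Carrier
  top  = ι⁻¹ top<q
  top′ = ι⁻¹ top′<q

  m<ι-top′ : m < ι top′
  m<ι-top′ = ≡.subst (m <_) (≡.sym (ι-ι⁻¹ top′<q)) (s≤s m≤2+n)

  m<ι-top : m < ι top
  m<ι-top = ≡.subst (m <_) (≡.sym (ι-ι⁻¹ top<q)) (ℕ.m≤n⇒m≤1+n (s≤s m≤2+n))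

  τ<ι-top : τ < ι top
  τ<ι-top = ℕ.≤-<-trans (shape-τ≤m shape) m<ι-top

  σ<ι-top : σ < ι top
  σ<ι-top = ≡.subst (σ <_) (≡.sym (ι-ι⁻¹ top<q)) (s≤s (ℕ.≤-trans (shape-σ≤1 shape) (s≤s z≤n)))

  top≉0 : top ≉ 0#
  top≉0 = <ι⇒≉0 m<ι-top

  meets-horizontal : ∀ {a c} → a ≈ 0# → ∃[ P ] (P satisfies graph a c × B P)
  meets-horizontal {a} {c} a≈0 with c ≟ 0# | m ℕ.<? ι c
  ... | yes c≈0 | _ = aff top 0# , aff-graph⁺ (sym (begin
    a * top + c   ≈⟨ +-cong (trans (*-congʳ a≈0) (zeroˡ top)) c≈0 ⟩
    0# + 0#       ≈⟨ +-identityʳ 0# ⟩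
    0#            ∎)) , y-axis∈B τ<ι-top
  ... | no _ | yes m<ιc = aff 0# c , aff-graph⁺ (sym (trans (+-congʳ (zeroʳ a)) (+-identityˡ c))) , z-axis∈B m<ιc
  ... | no c≉0 | no m≮ιc = aff c c , aff-graph⁺ (sym (trans (+-congʳ (trans (*-congʳ a≈0) (zeroˡ c))) (+-identityˡ c))) ,
                           diagonal∈B (≉0⇒0<ι c≉0 , ℕ.≮⇒≥ m≮ιc)

  meets-sloped : ∀ {a c} → a ≉ 0# → ∃[ P ] (P satisfies graph a c × B P × ¬ P satisfies vertical 0#)
  meets-sloped {a} {c} a≉0 with σ ℕ.<? ι a
  ... | yes σ<ιa = dir a , dir-graph⁺ refl , slope∈B σ<ιa , dir-vertical⁻ {s = a}
  ... | no σ≮ιa with missing-slope⇒skewed shape (≉0⇒0<ι a≉0) (ℕ.≮⇒≥ σ≮ιa) | c ≟ 0#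
  ...   | ιa≡1 , τ≡0 , _ | no c≉0 = aff (- c) 0# , aff-graph⁺ (sym (begin
    a * - c + c    ≈⟨ +-congʳ (*-congʳ (ι≡1⇒≈1 ιa≡1)) ⟩
    1# * - c + c   ≈⟨ solve 1 (λ c → con 1ℤ :* (:- c) :+ c := con 0ℤ) refl c ⟩
    0#             ∎)) , y-axis∈B (≡.subst (_< ι (- c)) (≡.sym τ≡0) (≉0⇒0<ι (-‿≉0 c≉0))) ,
    λ sat → -‿≉0 c≉0 (aff-vertical⁻ {z = 0#} sat)
  ...   | ιa≡1 , _ , m≡2 | yes c≈0 = aff 1# 1# , aff-graph⁺ (sym (begin
    a * 1# + c     ≈⟨ +-cong (trans (*-identityʳ a) (ι≡1⇒≈1 ιa≡1)) c≈0 ⟩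
    1# + 0#        ≈⟨ +-identityʳ 1# ⟩
    1#             ∎)) , diagonal∈B (≡.subst (0 <_) (≡.sym ι-1#) (s≤s z≤n) , ≡.subst₂ _≤_ (≡.sym ι-1#) (≡.sym m≡2) (s≤s z≤n)) ,
    λ sat → 1≉0 (aff-vertical⁻ {z = 1#} sat)

  meets-equation : ∀ e → ∃[ P ] (P satisfies e × B P)
  meets-equation atInfinity = dir top , refl , slope∈B σ<ι-top
  meets-equation (vertical c) with c ≟ 0# | τ ℕ.<? ι c
  ... | yes c≈0 | _ = aff 0# top , aff-vertical⁺ {z = top} (sym c≈0) , z-axis∈B m<ι-top
  ... | no _ | yes τ<ιc = aff c 0# , aff-vertical⁺ {z = 0#} refl , y-axis∈B τ<ιc
  ... | no c≉0 | no τ≮ιc = aff c c , aff-vertical⁺ {z = c} refl ,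
                           diagonal∈B (≉0⇒0<ι c≉0 , ℕ.≤-trans (ℕ.≮⇒≥ τ≮ιc) (shape-τ≤m shape))
  meets-equation (graph a c) with a ≟ 0#
  ... | yes a≈0 = meets-horizontal a≈0
  ... | no a≉0  = let P , sat , BP , _ = meets-sloped a≉0 in P , sat , BP

  origin∉B : ¬ B (aff 0# 0#)
  origin∉B BO with B-aff⁻ BO
  ... | y-axis _ τ<ι0      = <ι⇒≉0 τ<ι0 refl
  ... | z-axis _ m<ι0      = <ι⇒≉0 m<ι0 refl
  ... | diagonal _ 0<ι0 _  = <ι⇒≉0 0<ι0 refl

  avoids-sloped : ∀ {a c} → a ≉ 0# → c ≉ 0# → ∃[ P ] (P satisfies graph a c × ¬ B P)
  avoids-sloped {a} {c} a≉0 c≉0 =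
    aff y (a * y + c) , aff-graph⁺ refl , λ BP → avoided (B-aff⁻ BP)
    where
    -- where the line meets the z-axis, the y-axis and the diagonal
    roots : Fin 3 → Carrier
    roots Fin.zero                     = 0#
    roots (Fin.suc Fin.zero)           = a ⁻¹ * - c
    roots (Fin.suc (Fin.suc Fin.zero)) = (1# - a) ⁻¹ * c
    avoider = exists-avoiding (s≤s (s≤s (s≤s (s≤s z≤n)))) roots
    y : Carrier
    y = proj₁ avoider
    y≉roots : ∀ i → y ≉ roots i
    y≉roots = proj₂ avoider
    avoided : ¬ AffineMember y (a * y + c)
    avoided (z-axis y≈0 _) = y≉roots Fin.zero y≈0
    avoided (y-axis ay+c≈0 _) = y≉roots (Fin.suc Fin.zero) (x*y≈z⇒y≈x⁻¹*z a≉0 (begin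
      a * y                ≈⟨ solve 2 (λ u c → u := (u :+ c) :- c) refl (a * y) c ⟩
      (a * y + c) - c      ≈⟨ +-congʳ ay+c≈0 ⟩
      0# - c               ≈⟨ +-identityˡ (- c) ⟩
      - c                  ∎))
    avoided (diagonal y≈ay+c _ _) = off-diagonal ((1# - a) ≟ 0#)
      where
      [1-a]y≈c : (1# - a) * y ≈ c
      [1-a]y≈c = begin
        (1# - a) * y         ≈⟨ solve 2 (λ a y → (con 1ℤ :- a) :* y := y :- a :* y) refl a y ⟩
        y - a * y            ≈⟨ +-congʳ y≈ay+c ⟩
        (a * y + c) - a * y  ≈⟨ solve 2 (λ u c → (u :+ c) :- u := c) refl (a * y) c ⟩
        c                    ∎
      off-diagonal : Dec ((1# - a) ≈ 0#) → ⊥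
      off-diagonal (yes 1-a≈0) = c≉0 (trans (sym [1-a]y≈c) (trans (*-congʳ 1-a≈0) (zeroˡ y)))
      off-diagonal (no 1-a≉0)  = y≉roots (Fin.suc (Fin.suc Fin.zero)) (x*y≈z⇒y≈x⁻¹*z 1-a≉0 [1-a]y≈c)

  avoids-equation : ∀ e → ∃[ P ] (P satisfies e × ¬ B P)
  avoids-equation atInfinity   = dir∞ , refl , ¬B-dir∞
  avoids-equation (vertical c) = dir∞ , dir∞-vertical⁺ , ¬B-dir∞
  avoids-equation (graph a c) with c ≟ 0# | a ≟ 0#
  ... | yes c≈0 | _ = aff 0# 0# , aff-graph⁺ (sym (trans (+-cong (zeroʳ a) c≈0) (+-identityʳ 0#))) , origin∉B
  ... | no _ | yes a≈0 = dir 0# , dir-graph⁺ (sym a≈0) , λ B0 → <ι⇒≉0 (B-dir⁻ B0) refl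
  ... | no c≉0 | no a≉0 = avoids-sloped a≉0 c≉0

  blocking : IsBlockingSet B
  blocking L = let e , L-eq = line-equation L in
    (let P , sat , BP = meets-equation e in P , satisfies⇒on L-eq P sat , BP) ,
    (λ L⊆B → let P , sat , P∉B = avoids-equation e in P∉B (L⊆B P (satisfies⇒on L-eq P sat)))

  Only : Equation → Point → Set
  Only e P = ∀ Q → Q satisfies e → B Q → Q ≈P P

  tangent-line : ∀ P e → P satisfies e → Only e P → ∃[ L ] TangentAt B P L
  tangent-line P e sat only = lineOf e , satisfies⇒on H P sat , λ Q Q∈L BQ → only Q (on⇒satisfies H Q Q∈L) BQ
    where
    H = lineOf-equation e

  on-horizontal : ∀ {c} Q → c ≉ 0# → Q satisfies graph 0# c → B Q →
    (Q ≈P aff 0# c × m < ι c) ⊎ (Q ≈P aff c c × ι c ≤ m)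
  on-horizontal (dir s) _ sat BQ = contradiction (B-dir⁻ BQ) (λ σ<ιs → <ι⇒≉0 σ<ιs (dir-graph⁻ sat))
  on-horizontal dir∞ _ _ BQ = contradiction BQ ¬B-dir∞
  on-horizontal {c} (aff y z) c≉0 sat BQ = decode (B-aff⁻ BQ)
    where
    z≈c : z ≈ c
    z≈c = trans (aff-graph⁻ sat) (trans (+-congʳ (zeroˡ y)) (+-identityˡ c))
    decode : AffineMember y z → (aff y z ≈P aff 0# c × m < ι c) ⊎ (aff y z ≈P aff c c × ι c ≤ m)
    decode (y-axis z≈0 _)          = contradiction (trans (sym z≈c) z≈0) c≉0
    decode (z-axis y≈0 m<ιz)       = inj₁ ((refl , y≈0 , z≈c) , ≡.subst (m <_) (ι-cong z≈c) m<ιz)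
    decode (diagonal y≈z _ ιy≤m)   = inj₂ ((refl , trans y≈z z≈c , z≈c) , ≡.subst (_≤ m) (ι-cong (trans y≈z z≈c)) ιy≤m)

  tangent-at-z-axis : ∀ {z} → ZAxis z → ∃[ L ] TangentAt B (aff 0# z) L
  tangent-at-z-axis {z} m<ιz =
    tangent-line (aff 0# z) (graph 0# z) (aff-graph⁺ (sym (trans (+-congʳ (zeroˡ 0#)) (+-identityˡ z)))) only
    where
    only : Only (graph 0# z) (aff 0# z)
    only Q sat BQ with on-horizontal Q (<ι⇒≉0 m<ιz) sat BQ
    ... | inj₁ (Q≈P , _)    = Q≈P
    ... | inj₂ (_ , ιz≤m)   = contradiction ιz≤m (ℕ.<⇒≱ m<ιz)

  tangent-at-diagonal : ∀ {t} → Diagonal t → ∃[ L ] TangentAt B (aff t t) L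
  tangent-at-diagonal {t} (0<ιt , ιt≤m) =
    tangent-line (aff t t) (graph 0# t) (aff-graph⁺ (sym (trans (+-congʳ (zeroˡ t)) (+-identityˡ t)))) only
    where
    only : Only (graph 0# t) (aff t t)
    only Q sat BQ with on-horizontal Q (<ι⇒≉0 0<ιt) sat BQ
    ... | inj₁ (_ , m<ιt)   = contradiction ιt≤m (ℕ.<⇒≱ m<ιt)
    ... | inj₂ (Q≈P , _)    = Q≈P

  tangent-at-y-axis-vertical : ∀ {y₀} → YAxis y₀ → m < ι y₀ → ∃[ L ] TangentAt B (aff y₀ 0#) L
  tangent-at-y-axis-vertical {y₀} τ<ιy₀ m<ιy₀ = tangent-line (aff y₀ 0#) (vertical y₀) (aff-vertical⁺ {z = 0#} refl) only
    where
    only : Only (vertical y₀) (aff y₀ 0#)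
    only (dir s) sat _ = contradiction sat (dir-vertical⁻ {s = s})
    only dir∞ _ BQ = contradiction BQ ¬B-dir∞
    only (aff y z) sat BQ with B-aff⁻ BQ
    ... | y-axis z≈0 _        = refl , aff-vertical⁻ {z = z} sat , z≈0
    ... | z-axis y≈0 _        = contradiction (trans (sym (aff-vertical⁻ {z = z} sat)) y≈0) (<ι⇒≉0 τ<ιy₀)
    ... | diagonal _ _ ιy≤m   = contradiction (≡.subst (_≤ m) (ι-cong (aff-vertical⁻ {z = z} sat)) ιy≤m) (ℕ.<⇒≱ m<ιy₀)

  tangent-at-y-axis-sloped : ∀ {y₀} → YAxis y₀ → ι y₀ ≤ m → ∃[ L ] TangentAt B (aff y₀ 0#) L
  tangent-at-y-axis-sloped {y₀} τ<ιy₀ ιy₀≤m =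
    tangent-line (aff y₀ 0#) (graph 1# (- y₀)) (aff-graph⁺ (sym (solve 1 (λ y → con 1ℤ :* y :+ :- y := con 0ℤ) refl y₀))) only
    where
    σ≡1 = proj₁ (short-y⇒skewed shape τ<ιy₀ ιy₀≤m)
    m≡2 = proj₂ (short-y⇒skewed shape τ<ιy₀ ιy₀≤m)
    y₀≉0 : y₀ ≉ 0#
    y₀≉0 = <ι⇒≉0 τ<ιy₀
    only : Only (graph 1# (- y₀)) (aff y₀ 0#)
    only (dir s) sat BQ = contradiction (≡.subst₂ _<_ σ≡1 (≡.trans (ι-cong (dir-graph⁻ sat)) ι-1#) (B-dir⁻ BQ)) (ℕ.<-irrefl ≡.refl)
    only dir∞ _ BQ = contradiction BQ ¬B-dir∞
    only (aff y z) sat BQ with B-aff⁻ BQ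
    ... | y-axis z≈0 _ = refl , y≈y₀ , z≈0
      where
      y≈y₀ : y ≈ y₀
      y≈y₀ = x∙y⁻¹≈ε⇒x≈y _ _ (begin
        y - y₀                 ≈⟨ solve 2 (λ y y₀ → y :- y₀ := con 1ℤ :* y :+ :- y₀) refl y y₀ ⟩
        1# * y + - y₀          ≈⟨ aff-graph⁻ sat ⟨
        z                      ≈⟨ z≈0 ⟩
        0#                     ∎)
    ... | z-axis y≈0 m<ιz = contradiction m<ιz (ℕ.≤⇒≯ (≡.subst₂ _≤_ (ι-cong (sym z≈-y₀)) (≡.sym m≡2) (ι-‿≤2 (≉0⇒0<ι y₀≉0) ιy₀≤2)))
      where
      z≈-y₀ : z ≈ - y₀
      z≈-y₀ = trans (aff-graph⁻ sat) (trans (+-congʳ (trans (*-congˡ y≈0) (zeroʳ 1#))) (+-identityˡ (- y₀)))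
      ιy₀≤2 : ι y₀ ≤ 2
      ιy₀≤2 = ≡.subst (ι y₀ ≤_) m≡2 ιy₀≤m
    ... | diagonal y≈z _ _ = contradiction y₀≈0 y₀≉0
      where
      y₀≈0 : y₀ ≈ 0#
      y₀≈0 = begin
        y₀                     ≈⟨ solve 2 (λ y y₀ → y₀ := y :- (con 1ℤ :* y :+ :- y₀)) refl y y₀ ⟩
        y - (1# * y + - y₀)    ≈⟨ +-congˡ (-‿cong (aff-graph⁻ sat)) ⟨
        y - z                  ≈⟨ x≈y⇒x∙y⁻¹≈ε y≈z ⟩
        0#                     ∎

  tangent-at-y-axis : ∀ {y₀} → YAxis y₀ → ∃[ L ] TangentAt B (aff y₀ 0#) L
  tangent-at-y-axis {y₀} τ<ιy₀ with m ℕ.<? ι y₀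
  ... | yes m<ιy₀ = tangent-at-y-axis-vertical τ<ιy₀ m<ιy₀
  ... | no m≮ιy₀  = tangent-at-y-axis-sloped τ<ιy₀ (ℕ.≮⇒≥ m≮ιy₀)

  tangent-at-radial : ∀ {s} → Slopes s → ¬ (s ≈ 1# × 0 < m) → ∃[ L ] TangentAt B (dir s) L
  tangent-at-radial {s} σ<ιs not-diagonal =
    tangent-line (dir s) (graph s 0#) (dir-graph⁺ refl) only
    where
    s≉0 : s ≉ 0#
    s≉0 = <ι⇒≉0 σ<ιs
    z≈sy : ∀ {y z} → aff y z satisfies graph s 0# → z ≈ s * y
    z≈sy sat = trans (aff-graph⁻ sat) (+-identityʳ _)
    only : Only (graph s 0#) (dir s)
    only (dir s′) sat _ = refl , refl , dir-graph⁻ sat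
    only dir∞ _ BQ = contradiction BQ ¬B-dir∞
    only (aff y z) sat BQ with B-aff⁻ BQ
    ... | y-axis z≈0 τ<ιy = contradiction (x*y≈0⇒y≈0 s≉0 (trans (sym (z≈sy sat)) z≈0)) (<ι⇒≉0 τ<ιy)
    ... | z-axis y≈0 m<ιz = contradiction (trans (z≈sy sat) (trans (*-congˡ y≈0) (zeroʳ s))) (<ι⇒≉0 m<ιz)
    ... | diagonal y≈z 0<ιy ιy≤m = contradiction (s≈1 , ℕ.<-≤-trans 0<ιy ιy≤m) not-diagonal
      where
      s≈1 : s ≈ 1#
      s≈1 = x∙y⁻¹≈ε⇒x≈y _ _ (x*y≈0⇒y≈0 (<ι⇒≉0 0<ιy) (begin
        y * (s - 1#)   ≈⟨ solve 2 (λ y s → y :* (s :- con 1ℤ) := s :* y :- y) refl y s ⟩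
        s * y - y      ≈⟨ +-cong (sym (z≈sy sat)) (-‿cong y≈z) ⟩
        z - z          ≈⟨ -‿inverseʳ z ⟩
        0#             ∎))

  tangent-at-slope-one : ∀ {s} → Slopes s → s ≈ 1# → 0 < m → ∃[ L ] TangentAt B (dir s) L
  tangent-at-slope-one {s} σ<ιs s≈1 0<m = tangent-line (dir s) (graph 1# 1#) (dir-graph⁺ s≈1) only
    where
    balanced-facts = slope-one⇒balanced shape (≡.subst (σ <_) (≡.trans (ι-cong s≈1) ι-1#) σ<ιs) 0<m
    τ≡m = proj₁ balanced-facts
    2≤m = proj₂ balanced-facts
    only : Only (graph 1# 1#) (dir s)
    only (dir s′) sat _ = refl , refl , trans (dir-graph⁻ sat) (sym s≈1)
    only dir∞ _ BQ = contradiction BQ ¬B-dir∞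
    only (aff y z) sat BQ with B-aff⁻ BQ
    ... | y-axis z≈0 τ<ιy =
      contradiction τ<ιy (ℕ.≤⇒≯ (≡.subst₂ _≤_ (ι-cong (sym y≈-1)) (≡.sym τ≡m) (ℕ.≤-trans ι-‿1#≤2 2≤m)))
      where
      y≈-1 : y ≈ - 1#
      y≈-1 = begin
        y                        ≈⟨ solve 2 (λ y z → y := (con 1ℤ :* y :+ con 1ℤ) :- z :- con 1ℤ :+ z) refl y z ⟩
        (1# * y + 1#) - z - 1# + z ≈⟨ +-cong (+-congʳ (x≈y⇒x∙y⁻¹≈ε (sym (aff-graph⁻ sat)))) z≈0 ⟩
        0# - 1# + 0#             ≈⟨ solve 0 (con 0ℤ :- con 1ℤ :+ con 0ℤ := :- con 1ℤ) refl ⟩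
        - 1#                     ∎
    ... | z-axis y≈0 m<ιz = contradiction m<ιz (ℕ.≤⇒≯ (≡.subst (_≤ m) (≡.sym (≡.trans (ι-cong z≈1) ι-1#)) (ℕ.≤-trans (s≤s z≤n) 2≤m)))
      where
      z≈1 : z ≈ 1#
      z≈1 = trans (aff-graph⁻ sat) (trans (+-congʳ (trans (*-congˡ y≈0) (zeroʳ 1#))) (+-identityˡ 1#))
    ... | diagonal y≈z _ _ = contradiction 1≈0 1≉0
      where
      1≈0 : 1# ≈ 0#
      1≈0 = begin
        1#                        ≈⟨ solve 2 (λ y z → con 1ℤ := (con 1ℤ :* y :+ con 1ℤ) :- z :+ (z :- y)) refl y z ⟩
        (1# * y + 1#) - z + (z - y) ≈⟨ +-cong (x≈y⇒x∙y⁻¹≈ε (sym (aff-graph⁻ sat))) (x≈y⇒x∙y⁻¹≈ε (sym y≈z)) ⟩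
        0# + 0#                   ≈⟨ +-identityʳ 0# ⟩
        0#                        ∎
  tangent-at-slope : ∀ {s} → Slopes s → ∃[ L ] TangentAt B (dir s) L
  tangent-at-slope {s} σ<ιs with s ≟ 1# | 0 ℕ.<? m
  ... | yes s≈1 | yes 0<m = tangent-at-slope-one σ<ιs s≈1 0<m
  ... | yes s≈1 | no m≯0  = tangent-at-radial σ<ιs (λ (_ , 0<m) → m≯0 0<m)
  ... | no s≉1  | _       = tangent-at-radial σ<ιs (λ (s≈1 , _) → s≉1 s≈1)

  tangent : ∀ P → B P → ∃[ L ] TangentAt B P L
  tangent P (inj₁ BP)                 = Image-tangent dir (λ _ → tangent-at-slope) P BP
  tangent P (inj₂ (inj₁ BP))          = Image-tangent (λ y → aff y 0#) (λ _ → tangent-at-y-axis) P BP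
  tangent P (inj₂ (inj₂ (inj₁ BP)))   = Image-tangent (λ z → aff 0# z) (λ _ → tangent-at-z-axis) P BP
  tangent P (inj₂ (inj₂ (inj₂ BP)))   = Image-tangent (λ t → aff t t) (λ _ → tangent-at-diagonal) P BP

  minimal : IsMinimalBlockingSet B
  minimal = tangents⇒minimal blocking tangent

  P₀ : Point
  P₀ = aff 0# top

  top≉top′ : top ≉ top′
  top≉top′ top≈top′ = ℕ.1+n≢n (≡.trans (≡.sym (ι-ι⁻¹ top<q)) (≡.trans (ι-cong top≈top′) (ι-ι⁻¹ top′<q)))

  secant-through-P₀ : ∀ {L} e → L HasEquation e → P₀ satisfies e → ¬ dir 0# satisfies e → Secant B L
  secant-through-P₀ atInfinity _ P₀-sat _ = contradiction P₀-sat 1≉0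
  secant-through-P₀ (vertical c) L-eq P₀-sat _ =
    P₀ , aff 0# top′ , satisfies⇒on L-eq P₀ P₀-sat , z-axis∈B m<ι-top ,
    satisfies⇒on L-eq (aff 0# top′) (aff-vertical⁺ {z = top′} (aff-vertical⁻ {z = top} P₀-sat)) , z-axis∈B m<ι-top′ ,
    λ (_ , _ , top≈top′) → top≉top′ top≈top′
  secant-through-P₀ (graph a c) L-eq P₀-sat dir₀∉ =
    P₀ , Q , satisfies⇒on L-eq P₀ P₀-sat , z-axis∈B m<ι-top , satisfies⇒on L-eq Q Q-sat , BQ ,
    λ P₀≈Q → Q-off (satisfies-resp (vertical 0#) {P₀} {Q} P₀≈Q (aff-vertical⁺ {z = top} refl))
    where
    a≉0 : a ≉ 0#
    a≉0 a≈0 = dir₀∉ (dir-graph⁺ (sym a≈0))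
    sloped = meets-sloped {a} {c} a≉0
    Q     = proj₁ sloped
    Q-sat = proj₁ (proj₂ sloped)
    BQ    = proj₁ (proj₂ (proj₂ sloped))
    Q-off = proj₂ (proj₂ (proj₂ sloped))

  rInf : RInfProperty B P₀
  rInf = rInf-property {B} {P₀} {L₀} (z-axis∈B m<ι-top) P₀-tangent others
    where
    L₀ = lineOf (graph 0# top)
    P₀-tangent : TangentAt B P₀ L₀
    P₀-tangent = proj₂ (tangent-at-z-axis m<ι-top)
    others : ∀ L → P₀ on L → L ≈L L₀ ⊎ Secant B L
    others L P₀∈L with dir 0# on? L
    ... | yes dir₀∈L = inj₁ (horizontal-unique {L = L} {L₀} top≉0 dir₀∈L P₀∈L
                               (satisfies⇒on (lineOf-equation (graph 0# top)) (dir 0#) (dir-graph⁺ refl)) (proj₁ P₀-tangent))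
    ... | no dir₀∉L  = let e , L-eq = line-equation L in
      inj₂ (secant-through-P₀ e L-eq (on⇒satisfies L-eq P₀ P₀∈L) (dir₀∉L ∘ satisfies⇒on L-eq (dir 0#)))

  slopes-disjoint : ∀ P → SlopePoints P → (YAxisPoints ∪ ZAxisPoints ∪ DiagonalPoints) P → ⊥
  slopes-disjoint P SP (inj₁ YP)        = Image-disjoint dir (λ y → aff y 0#) (λ _ _ _ _ (0≈1 , _) → 1≉0 (sym 0≈1)) P SP YP
  slopes-disjoint P SP (inj₂ (inj₁ ZP)) = Image-disjoint dir (λ z → aff 0# z) (λ _ _ _ _ (0≈1 , _) → 1≉0 (sym 0≈1)) P SP ZP
  slopes-disjoint P SP (inj₂ (inj₂ DP)) = Image-disjoint dir (λ t → aff t t) (λ _ _ _ _ (0≈1 , _) → 1≉0 (sym 0≈1)) P SP DP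

  y-axis-disjoint : ∀ P → YAxisPoints P → (ZAxisPoints ∪ DiagonalPoints) P → ⊥
  y-axis-disjoint P YP (inj₁ ZP) =
    Image-disjoint (λ y → aff y 0#) (λ z → aff 0# z) (λ _ _ τ<ιy _ (_ , y≈0 , _) → <ι⇒≉0 τ<ιy y≈0) P YP ZP
  y-axis-disjoint P YP (inj₂ DP) =
    Image-disjoint (λ y → aff y 0#) (λ t → aff t t) (λ _ _ _ (0<ιt , _) (_ , _ , 0≈t) → <ι⇒≉0 0<ιt (sym 0≈t)) P YP DP

  z-axis-disjoint : ∀ P → ZAxisPoints P → DiagonalPoints P → ⊥
  z-axis-disjoint = Image-disjoint (λ z → aff 0# z) (λ t → aff t t) (λ _ _ _ (0<ιt , _) (_ , 0≈t , _) → <ι⇒≉0 0<ιt (sym 0≈t))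

  size : HasSize B (size-formula n σ τ m)
  size = HasSize-∪ |slopes| (HasSize-∪ |y-axis| (HasSize-∪ |z-axis| |diagonal| z-axis-disjoint) y-axis-disjoint) slopes-disjoint
    where
    m≤ : m ≤ 4 ℕ.+ n
    m≤ = ℕ.≤-trans m≤2+n (ℕ.m≤n+m _ 2)
    |slopes| = HasSize-Image dir (λ x≈y → refl , refl , x≈y) (λ (_ , _ , x≈y) → x≈y)
               (above σ (ℕ.≤-trans (shape-σ≤1 shape) (s≤s z≤n)))
    |y-axis| = HasSize-Image (λ y → aff y 0#) (λ x≈y → refl , x≈y , refl) (λ (_ , x≈y , _) → x≈y)
               (above τ (ℕ.≤-trans (shape-τ≤m shape) m≤))
    |z-axis| = HasSize-Image (λ z → aff 0# z) (λ x≈y → refl , refl , x≈y) (λ (_ , _ , x≈y) → x≈y) (above m m≤)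
    |diagonal| = HasSize-Image (λ t → aff t t) (λ x≈y → refl , x≈y , x≈y) (λ (_ , x≈y , _) → x≈y) (interval 0 m (s≤s m≤))

  B-resp : RespectsEq B
  B-resp {P} {Q} P≈Q (inj₁ SP)               = inj₁ (Image-resp dir Slopes P Q P≈Q SP)
  B-resp {P} {Q} P≈Q (inj₂ (inj₁ YP))        = inj₂ (inj₁ (Image-resp (λ y → aff y 0#) YAxis P Q P≈Q YP))
  B-resp {P} {Q} P≈Q (inj₂ (inj₂ (inj₁ ZP))) = inj₂ (inj₂ (inj₁ (Image-resp (λ z → aff 0# z) ZAxis P Q P≈Q ZP)))
  B-resp {P} {Q} P≈Q (inj₂ (inj₂ (inj₂ DP))) = inj₂ (inj₂ (inj₂ (Image-resp (λ t → aff t t) Diagonal P Q P≈Q DP)))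

MinimalRInfBlockingSet : ∀ {q} → FiniteField q → ℕ → Set₁
MinimalRInfBlockingSet F k =
  let open PG F in ∃[ S ] (RespectsEq S × HasSize S k × IsMinimalBlockingSet S × ∃[ P ] RInfProperty S P)

construction : ∀ {n σ τ m} (F : FiniteField (5 ℕ.+ n)) → Shape σ τ m → m ≤ 2 ℕ.+ n →
  MinimalRInfBlockingSet F (size-formula n σ τ m)
construction F shape m≤2+n = B , (λ {P} {Q} → B-resp {P} {Q}) , size , minimal , P₀ , rInf
  where open Construction F shape m≤2+n

skewed-size : ∀ n → size-formula n 1 0 2 ℕ.+ 1 ≡ 3 ℕ.* (4 ℕ.+ n)
skewed-size = total
  where
  total : ∀ n → (3 ℕ.+ n) ℕ.+ ((4 ℕ.+ n) ℕ.+ ((2 ℕ.+ n) ℕ.+ 2)) ℕ.+ 1 ≡ 3 ℕ.* (4 ℕ.+ n)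
  total = solve-∀

balanced-size : ∀ n m → m ≤ 4 ℕ.+ n → size-formula n 0 m m ℕ.+ m ≡ 3 ℕ.* (4 ℕ.+ n)
balanced-size n m m≤N = begin
  N ℕ.+ ((N ℕ.∸ m) ℕ.+ ((N ℕ.∸ m) ℕ.+ m)) ℕ.+ m  ≡⟨ regroup N (N ℕ.∸ m) m ⟩
  N ℕ.+ ((N ℕ.∸ m) ℕ.+ m) ℕ.+ ((N ℕ.∸ m) ℕ.+ m)  ≡⟨ ≡.cong₂ (λ x y → N ℕ.+ x ℕ.+ y) N-m+m≡N N-m+m≡N ⟩
  N ℕ.+ N ℕ.+ N                                  ≡⟨ triple N ⟩
  3 ℕ.* N                                        ∎
  where
  open ≡.≡-Reasoning
  N = 4 ℕ.+ n
  N-m+m≡N : (N ℕ.∸ m) ℕ.+ m ≡ N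
  N-m+m≡N = ℕ.m∸n+n≡m m≤N
  regroup : ∀ N d m → N ℕ.+ (d ℕ.+ (d ℕ.+ m)) ℕ.+ m ≡ N ℕ.+ (d ℕ.+ m) ℕ.+ (d ℕ.+ m)
  regroup = solve-∀
  triple : ∀ N → N ℕ.+ N ℕ.+ N ≡ 3 ℕ.* N
  triple = solve-∀

defect-bound : ∀ n k → 2 ℕ.* (5 ℕ.+ n) ≤ k → 3 ℕ.* (4 ℕ.+ n) ℕ.∸ k ≤ 2 ℕ.+ n
defect-bound n k 2q≤k = begin
  3 ℕ.* (4 ℕ.+ n) ℕ.∸ k                              ≤⟨ ℕ.∸-monoʳ-≤ (3 ℕ.* (4 ℕ.+ n)) 2q≤k ⟩
  3 ℕ.* (4 ℕ.+ n) ℕ.∸ 2 ℕ.* (5 ℕ.+ n)                ≡⟨ ≡.cong (ℕ._∸ 2 ℕ.* (5 ℕ.+ n)) (split n) ⟩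
  2 ℕ.* (5 ℕ.+ n) ℕ.+ (2 ℕ.+ n) ℕ.∸ 2 ℕ.* (5 ℕ.+ n)  ≡⟨ ℕ.m+n∸m≡n (2 ℕ.* (5 ℕ.+ n)) (2 ℕ.+ n) ⟩
  2 ℕ.+ n                                            ∎
  where
  open ℕ.≤-Reasoning
  split : ∀ n → 3 ℕ.* (4 ℕ.+ n) ≡ 2 ℕ.* (5 ℕ.+ n) ℕ.+ (2 ℕ.+ n)
  split = solve-∀

parameters : ∀ n k → 2 ℕ.* (5 ℕ.+ n) ≤ k → k ≤ 3 ℕ.* (4 ℕ.+ n) →
  ∃[ σ ] ∃[ τ ] ∃[ m ] (Shape σ τ m × m ≤ 2 ℕ.+ n × size-formula n σ τ m ≡ k)
parameters n k 2q≤k k≤3N with 3 ℕ.* (4 ℕ.+ n) ℕ.∸ k ℕ.≟ 1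
... | yes d≡1 = 1 , 0 , 2 , skewed , s≤s (s≤s z≤n) ,
  ℕ.+-cancelʳ-≡ 1 _ _ (≡.trans (skewed-size n) (≡.trans (≡.sym k+d≡3N) (≡.cong (k ℕ.+_) d≡1)))
  where
  k+d≡3N = ℕ.m+[n∸m]≡n k≤3N
... | no d≢1 = 0 , d , d , balanced d≢1 , d≤2+n ,
  ℕ.+-cancelʳ-≡ d _ _ (≡.trans (balanced-size n d (ℕ.≤-trans d≤2+n (ℕ.m≤n+m _ 2))) (≡.sym (ℕ.m+[n∸m]≡n k≤3N)))
  where
  d = 3 ℕ.* (4 ℕ.+ n) ℕ.∸ k
  d≤2+n = defect-bound n k 2q≤k

open import Data.Nat using (_*_; _∸_)

theorem3p12 : ∀ (q : ℕ) → IsPrimePower q → 5 ≤ q → (F : FiniteField q) →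
    let open PG F in
    ∀ (k : ℕ) → 2 * q ≤ k → k ≤ 3 * (q ∸ 1) →
    ∃[ S ] (RespectsEq S × HasSize S k × IsMinimalBlockingSet S × ∃[ P ] RInfProperty S P)
theorem3p12 _ _ (s≤s (s≤s (s≤s (s≤s (s≤s (z≤n {n})))))) F k 2q≤k k≤3[q-1] =
  let σ , τ , m , shape , m≤2+n , size≡k = parameters n k 2q≤k k≤3[q-1]
  in ≡.subst (MinimalRInfBlockingSet F) size≡k (construction F shape m≤2+n)
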